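{- Let $\Lambda$ be a superpartition of fermionic degree $m$. Then \[ \zeta_\Lambda=n\bigl((\Lambda')^a\bigr)-n(\delta_m)=n\bigl((\Lambda')^a/\delta_m\bigr). \]
   Context: A superpartition of fermionic degree $m$ is $\Lambda=(\Lambda^a;\Lambda^s)=(\Lambda_1,\dots,\Lambda_m;\Lambda_{m+1},\dots,\Lambda_\ell)$ with $\Lambda_1>\dots>\Lambda_m\ge0$ and $\Lambda_{m+1}\ge\dots\ge\Lambda_\ell>0$ integers. $\Lambda^*$ is the partition obtained by sorting $\Lambda_1,\dots,\Lambda_\ell$; $\Lambda^\circledast$ that obtained by sorting $\Lambda_1+1,\dots,\Lambda_m+1,\Lambda_{m+1},\dots,\Lambda_\ell$. The diagram of $\Lambda$ is the Ferrers diagram of $\Lambda^*$ (cell $(i,j)$ in row $i$ from the top and column $j$) with the cells of $\Lambda^\circledast/\Lambda^*$ drawn as circles (at most one per row and column). The conjugate $\Lambda'$ is the superpartition with $(\Lambda')^*=(\Lambda^*)'$, $(\Lambda')^\circledast=(\Lambda^\circledast)'$; $(\Lambda')^a$ is its first component (a partition with $m$ distinct parts, one possibly $0$). $\delta_m=(m-1,m-2,\dots,0)$; $n(\lambda)=\sum_i(i-1)\lambda_i$ and $n(\lambda/\mu)=n(\lambda)-n(\mu)$. $\zeta_\Lambda$: call a (non-circle) cell of the diagram fermionic if its row contains a circle and its column contains a circle. For each fermionic cell $s$, count the cells of $\Lambda^*$ lying strictly above $s$ in the same column and in rows containing no circle; $\zeta_\Lambda$ is the sum of these counts over all fermionic cells.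 -}

module Defs where

open import Data.Nat using (ℕ; zero; suc; _+_; _*_; _∸_; _≤_; _<_; _>_; _≥_; _≤ᵇ_; _≡ᵇ_)
open import Data.Bool using (Bool; true; false; not; _∧_; if_then_else_)
open import Data.List using (List; []; _∷_; _++_; map; length; filter; foldr; upTo; downFrom)
open import Data.Nat.ListAction using (sum)
open import Data.Bool.ListAction using (any)
open import Data.List.Relation.Unary.All using (All)
open import Data.List.Relation.Unary.Linked using (Linked)
open import Data.Product using (_×_)
open import Relation.Binary.PropositionalEquality using (_≡_)

-- Lists are 0-indexed; out-of-range entries read as 0.
get : List ℕ → ℕ → ℕ
get []       _       = 0
get (x ∷ _)  zero    = x
get (_ ∷ xs) (suc i) = get xs i

Σ< : ℕ → (ℕ → ℕ) → ℕ
Σ< n f = sum (map f (upTo n))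

[_] : Bool → ℕ
[ true ]  = 1
[ false ] = 0

insert : ℕ → List ℕ → List ℕ
insert x []       = x ∷ []
insert x (y ∷ ys) = if y ≤ᵇ x then x ∷ y ∷ ys else y ∷ insert x ys

sortDesc : List ℕ → List ℕ
sortDesc = foldr insert []

partOf : List ℕ → List ℕ
partOf xs = filter (λ x → 1 Data.Nat.≤? x) (sortDesc xs)

maxOf : List ℕ → ℕ
maxOf = foldr Data.Nat._⊔_ 0

conj : List ℕ → List ℕ
conj λs = map (λ j → length (filter (λ x → suc j Data.Nat.≤? x) λs)) (upTo (maxOf λs))

-- n(λ) = Σ_i (i-1) λ_i  (1-indexed), i.e. Σ_i i λ_i 0-indexed
nPart : List ℕ → ℕ
nPart λs = Σ< (length λs) (λ i → i * get λs i)

δ : ℕ → List ℕ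
δ m = downFrom m

record SuperPartition : Set where
  constructor sp
  field
    anti : List ℕ
    sym  : List ℕ

open SuperPartition public

IsSuperPartition : SuperPartition → Set
IsSuperPartition Λ = Linked _>_ (anti Λ) × Linked _≥_ (sym Λ) × All (λ x → x > 0) (sym Λ)

fermDeg : SuperPartition → ℕ
fermDeg Λ = length (anti Λ)

star : SuperPartition → List ℕ
star Λ = partOf (anti Λ ++ sym Λ)

circ : SuperPartition → List ℕ
circ Λ = partOf (map suc (anti Λ) ++ sym Λ)

-- row i (0-indexed) contains a circle (a cell of Λ^⊛ / Λ^*)
rowCirc : SuperPartition → ℕ → Bool
rowCirc Λ i = not (get (circ Λ) i ≡ᵇ get (star Λ) i)

-- column j (1-indexed) contains a circle: some circled row i has its circle,
-- cell (i, Λ^⊛_i), in column j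
colCirc : SuperPartition → ℕ → Bool
colCirc Λ j = any (λ i → rowCirc Λ i ∧ (get (circ Λ) i ≡ᵇ j)) (upTo (length (circ Λ)))

-- ζ_Λ : sum over fermionic cells s = (i,j) of Λ^* (row i circled, column j circled)
-- of the number of cells (k,j) of Λ^* with k < i and row k containing no circle.
ζ : SuperPartition → ℕ
ζ Λ = Σ< (length (star Λ)) λ i →
        Σ< (get (star Λ) i) λ j₀ →
          [ rowCirc Λ i ∧ colCirc Λ (suc j₀) ] *
          Σ< i (λ k → [ not (rowCirc Λ k) ∧ (suc j₀ ≤ᵇ get (star Λ) k) ])

module Submission where

-- List the rows of the diagram of Λ from the top, recording for each its length in Λ^* and whether
-- it ends with a circle.  Fix a circled row i of length ℓ and let w be the number of circled rows
-- shorter than ℓ, i.e. the number of circles in columns 1, ..., ℓ.  The rows above i are exactly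
-- the rows longer than ℓ, so the fermionic cells of row i are its w cells under those circles, each
-- seeing all p uncircled rows above i: row i contributes p w to ζ_Λ.  If r circled rows lie above i
-- then m - 1 - r = w, so row i contributes r w to n(δ_m).  Conjugation turns the circle of row i
-- into a circled row of Λ' of length i (the number of rows longer than ℓ) with w circled rows above
-- it, contributing i w to n((Λ')^a).  Since p + r = i, the identity follows row by row.

open import Defs
open import Defs using () renaming (sym to symmetric)
open import Data.Nat using (ℕ; zero; suc; _+_; _*_; _∸_; _≤_; _<_; _>_; _≥_; _≤ᵇ_; _<ᵇ_; _≡ᵇ_; z≤n; s≤s; _≤?_; _<?_; _≟_)
open import Data.Nat.Properties
open import Algebra.Properties.CommutativeSemigroup +-commutativeSemigroup using () renaming (interchange to +-interchange)
open import Data.Bool using (Bool; true; false; not; _∧_; if_then_else_; T)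
open import Data.Bool.Properties using (∧-identityʳ; ∧-conicalˡ; ∧-conicalʳ)
open import Data.Bool.ListAction using (any; or)
open import Data.List using (List; []; _∷_; _++_; map; length; filter; foldr; upTo; downFrom; applyUpTo)
open import Data.List.Properties using (map-applyUpTo; length-applyUpTo; map-id; map-∘; foldr-++; filter-all; length-filter; length-map; length-downFrom)
open import Data.List.Relation.Unary.All using (All; []; _∷_; universal)
open import Data.List.Relation.Unary.All.Properties using (map⁺)
open import Data.List.Relation.Unary.Linked using (Linked; []; [-]; _∷_)
import Data.List.Relation.Unary.Linked as Linked
open import Data.List.Relation.Unary.Linked.Properties using (Linked⇒All) renaming (map⁺ to Linked-map⁺)
open import Data.Nat.ListAction using (sum)
open import Data.Product using (proj₁; proj₂)
open import Data.Sum using (inj₁; inj₂)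
open import Function using (_∘_)
open import Relation.Binary using (tri<; tri≈; tri>)
open import Relation.Binary.PropositionalEquality using (_≡_; ≢-sym; refl; cong; cong₂; trans; subst; module ≡-Reasoning)
  renaming (sym to ≡-sym)
open import Relation.Nullary using (yes; no; contradiction)
open import Relation.Nullary.Decidable using (dec-true; dec-false)

-- Finite sums

∑ : ℕ → (ℕ → ℕ) → ℕ
∑ zero    f = 0
∑ (suc n) f = f 0 + ∑ n (f ∘ suc)

syntax ∑ n (λ i → e) = ∑[ i < n ] e

Σ<≡∑ : ∀ n f → Σ< n f ≡ ∑ n f
Σ<≡∑ n f = trans (cong sum (map-applyUpTo (λ i → i) f n)) (sum-applyUpTo n f)
  where
  sum-applyUpTo : ∀ n f → sum (applyUpTo f n) ≡ ∑ n f
  sum-applyUpTo zero    f = refl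
  sum-applyUpTo (suc n) f = cong (f 0 +_) (sum-applyUpTo n (f ∘ suc))

∑-cong : ∀ n {f g : ℕ → ℕ} → (∀ i → i < n → f i ≡ g i) → ∑ n f ≡ ∑ n g
∑-cong zero    f≡g = refl
∑-cong (suc n) f≡g = cong₂ _+_ (f≡g 0 (s≤s z≤n)) (∑-cong n (λ i i<n → f≡g (suc i) (s≤s i<n)))

∑-zero : ∀ n f → (∀ i → i < n → f i ≡ 0) → ∑ n f ≡ 0
∑-zero zero    f f≡0 = refl
∑-zero (suc n) f f≡0 = cong₂ _+_ (f≡0 0 (s≤s z≤n)) (∑-zero n (f ∘ suc) (λ i i<n → f≡0 (suc i) (s≤s i<n)))

∑-one : ∀ n → ∑[ _ < n ] 1 ≡ n
∑-one zero    = refl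
∑-one (suc n) = cong suc (∑-one n)

∑-suc : ∀ n f → ∑ (suc n) f ≡ ∑ n f + f n
∑-suc zero    f = +-comm (f 0) 0
∑-suc (suc n) f = trans (cong (f 0 +_) (∑-suc n (f ∘ suc))) (≡-sym (+-assoc (f 0) _ _))

∑-+ : ∀ n f g → ∑[ i < n ] (f i + g i) ≡ ∑ n f + ∑ n g
∑-+ zero    f g = refl
∑-+ (suc n) f g = trans (cong (f 0 + g 0 +_) (∑-+ n (f ∘ suc) (g ∘ suc))) (+-interchange (f 0) (g 0) _ _)

∑-*ˡ : ∀ n c f → ∑[ i < n ] (c * f i) ≡ c * ∑ n f
∑-*ˡ zero    c f = ≡-sym (*-zeroʳ c)
∑-*ˡ (suc n) c f = trans (cong (c * f 0 +_) (∑-*ˡ n c (f ∘ suc))) (≡-sym (*-distribˡ-+ c (f 0) _))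

∑-*ʳ : ∀ n c f → ∑[ i < n ] (f i * c) ≡ ∑ n f * c
∑-*ʳ n c f = trans (∑-cong n (λ i _ → *-comm (f i) c)) (trans (∑-*ˡ n c f) (*-comm c _))

∑-split : ∀ a b f → ∑ (a + b) f ≡ ∑ a f + ∑[ k < b ] f (a + k)
∑-split zero    b f = refl
∑-split (suc a) b f = trans (cong (f 0 +_) (∑-split a b (f ∘ suc))) (≡-sym (+-assoc (f 0) _ _))

∑-extend : ∀ n N f → n ≤ N → (∀ i → n ≤ i → i < N → f i ≡ 0) → ∑ n f ≡ ∑ N f
∑-extend n N f n≤N tail≡0 = begin
  ∑ n f                          ≡⟨ ≡-sym (+-identityʳ _) ⟩
  ∑ n f + 0                      ≡⟨ cong (∑ n f +_) (≡-sym (∑-zero (N ∸ n) _ tail≡0′)) ⟩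
  ∑ n f + ∑[ k < N ∸ n ] f (n + k) ≡⟨ ≡-sym (∑-split n (N ∸ n) f) ⟩
  ∑ (n + (N ∸ n)) f              ≡⟨ cong (λ k → ∑ k f) (m+[n∸m]≡n n≤N) ⟩
  ∑ N f                          ∎
  where
  open ≡-Reasoning
  tail≡0′ : ∀ k → k < N ∸ n → f (n + k) ≡ 0
  tail≡0′ k k<N∸n = tail≡0 (n + k) (m≤m+n n k) (subst (n + k <_) (m+[n∸m]≡n n≤N) (+-monoʳ-< n k<N∸n))

∑-comm : ∀ n m (f : ℕ → ℕ → ℕ) → ∑[ j < n ] ∑[ i < m ] f i j ≡ ∑[ i < m ] ∑[ j < n ] f i j
∑-comm zero    m f = ≡-sym (∑-zero m _ (λ _ _ → refl))
∑-comm (suc n) m f = trans (cong (∑[ i < m ] f i 0 +_) (∑-comm n m (λ i j → f i (suc j))))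
                           (≡-sym (∑-+ m _ _))

∑-δ : ∀ n v (h : ℕ → ℕ) → ∑[ j < n ] ([ v ≡ᵇ j ] * h j) ≡ [ v <ᵇ n ] * h v
∑-δ zero    v       h = refl
∑-δ (suc n) zero    h = trans (cong (h 0 + 0 +_) (∑-zero n _ (λ _ _ → refl))) (+-identityʳ _)
∑-δ (suc n) (suc v) h = ∑-δ n v (h ∘ suc)

∑-[≡ᵇ] : ∀ n v → ∑[ j < n ] [ v ≡ᵇ j ] ≡ [ v <ᵇ n ]
∑-[≡ᵇ] n v = trans (∑-cong n (λ j _ → ≡-sym (*-identityʳ _))) (trans (∑-δ n v (λ _ → 1)) (*-identityʳ _))

∑-truncate : ∀ n N (g : ℕ → ℕ) → n ≤ N → ∑[ k < N ] (g k * [ k <ᵇ n ]) ≡ ∑ n g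
∑-truncate n N g n≤N = begin
  ∑[ k < N ] (g k * [ k <ᵇ n ]) ≡⟨ ≡-sym (∑-extend n N _ n≤N (λ i n≤i _ → beyond i n≤i)) ⟩
  ∑[ k < n ] (g k * [ k <ᵇ n ]) ≡⟨ ∑-cong n within ⟩
  ∑ n g                         ∎
  where
  open ≡-Reasoning
  beyond : ∀ i → n ≤ i → g i * [ i <ᵇ n ] ≡ 0
  beyond i n≤i rewrite dec-false (i <? n) (≤⇒≯ n≤i) = *-zeroʳ (g i)
  within : ∀ i → i < n → g i * [ i <ᵇ n ] ≡ g i
  within i i<n rewrite dec-true (i <? n) i<n = *-identityʳ (g i)

[]-∧ : ∀ a b → [ a ∧ b ] ≡ [ a ] * [ b ]
[]-∧ true  b = ≡-sym (+-identityʳ [ b ])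
[]-∧ false b = refl

[]-not : ∀ b → [ not b ] + [ b ] ≡ 1
[]-not true  = refl
[]-not false = refl

<ᵇ-suc-not : ∀ i k → (k <ᵇ suc i) ≡ not (i <ᵇ k)
<ᵇ-suc-not i k with i <? k
... | yes i<k rewrite dec-true (i <? k) i<k = dec-false (k <? suc i) (<⇒≱ i<k ∘ ≤-pred)
... | no  i≮k rewrite dec-false (i <? k) i≮k = dec-true (k <? suc i) (s≤s (≮⇒≥ i≮k))

∑-[not]+∑-[] : ∀ (b : ℕ → Bool) i → ∑[ k < i ] [ not (b k) ] + ∑[ k < i ] [ b k ] ≡ i
∑-[not]+∑-[] b i = trans (≡-sym (∑-+ i _ _)) (trans (∑-cong i (λ k _ → []-not (b k))) (∑-one i))

∑-rank : ∀ (b : ℕ → Bool) n (f : ℕ → ℕ) → ∑[ i < n ] ([ b i ] * f (∑[ k < i ] [ b k ])) ≡ ∑ (∑[ i < n ] [ b i ]) f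
∑-rank b zero    f = refl
∑-rank b (suc n) f = begin
  ∑[ i < suc n ] ([ b i ] * f (rank i))          ≡⟨ ∑-suc n _ ⟩
  ∑[ i < n ] ([ b i ] * f (rank i)) + [ b n ] * f (rank n) ≡⟨ cong (_+ [ b n ] * f (rank n)) (∑-rank b n f) ⟩
  ∑ (rank n) f + [ b n ] * f (rank n)            ≡⟨ last (b n) ⟩
  ∑ (rank n + [ b n ]) f                         ≡⟨ cong (λ k → ∑ k f) (∑-suc n (λ i → [ b i ])) ⟨
  ∑ (rank (suc n)) f                             ∎
  where
  open ≡-Reasoning
  rank : ℕ → ℕ
  rank i = ∑[ k < i ] [ b k ]
  last : ∀ β → ∑ (rank n) f + [ β ] * f (rank n) ≡ ∑ (rank n + [ β ]) f
  last false = trans (+-identityʳ _) (cong (λ k → ∑ k f) (≡-sym (+-identityʳ (rank n))))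
  last true  = trans (cong (∑ (rank n) f +_) (+-identityʳ (f (rank n))))
                     (trans (≡-sym (∑-suc (rank n) f)) (cong (λ k → ∑ k f) (+-comm 1 (rank n))))

[or-applyUpTo]≡∑ : ∀ n (g : ℕ → Bool) → (∀ a b → g a ≡ true → g b ≡ true → a ≡ b) →
                 [ or (applyUpTo g n) ] ≡ ∑[ i < n ] [ g i ]
[or-applyUpTo]≡∑ zero    g unique = refl
[or-applyUpTo]≡∑ (suc n) g unique with g 0 in g0
... | true  = cong suc (≡-sym (∑-zero n _ (λ i _ → only-at-0 i)))
  where
  only-at-0 : ∀ i → [ g (suc i) ] ≡ 0
  only-at-0 i with g (suc i) in gi
  ... | true  = contradiction (unique 0 (suc i) g0 gi) 0≢1+n
  ... | false = refl
... | false = [or-applyUpTo]≡∑ n (g ∘ suc) (λ a b ga gb → suc-injective (unique (suc a) (suc b) ga gb))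

[any]≡∑ : ∀ n (g : ℕ → Bool) → (∀ a b → g a ≡ true → g b ≡ true → a ≡ b) →
          [ any g (upTo n) ] ≡ ∑[ i < n ] [ g i ]
[any]≡∑ n g unique = trans (cong (λ bs → [ or bs ]) (map-applyUpTo (λ i → i) g n)) ([or-applyUpTo]≡∑ n g unique)

-- Partitions as lists

≤ᵇ≡true⇒≤ : ∀ {m n} → (m ≤ᵇ n) ≡ true → m ≤ n
≤ᵇ≡true⇒≤ {m} {n} eq = ≤ᵇ⇒≤ m n (subst T (≡-sym eq) _)

≡ᵇ≡true⇒≡ : ∀ {m n} → (m ≡ᵇ n) ≡ true → m ≡ n
≡ᵇ≡true⇒≡ {m} {n} eq = ≡ᵇ⇒≡ m n (subst T (≡-sym eq) _)

≤ᵇ≡false⇒> : ∀ {m n} → (m ≤ᵇ n) ≡ false → n < m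
≤ᵇ≡false⇒> eq = ≰⇒> (λ m≤n → subst T eq (≤⇒≤ᵇ m≤n))

insert-≥ : ∀ {x y} ys → y ≤ x → insert x (y ∷ ys) ≡ x ∷ y ∷ ys
insert-≥ {x} {y} ys y≤x rewrite dec-true (y ≤? x) y≤x = refl

insert-< : ∀ {x y} ys → x < y → insert x (y ∷ ys) ≡ y ∷ insert x ys
insert-< {x} {y} ys x<y rewrite dec-false (y ≤? x) (<⇒≱ x<y) = refl

sortDesc-sorted : ∀ {xs} → Linked _≥_ xs → sortDesc xs ≡ xs
sortDesc-sorted {[]}         _           = refl
sortDesc-sorted {x ∷ []}     _           = refl
sortDesc-sorted {x ∷ y ∷ xs} (x≥y ∷ ys↘) =
  trans (cong (insert x) (sortDesc-sorted ys↘)) (insert-≥ xs x≥y)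

sortDesc-++-sorted : ∀ xs {s} → Linked _≥_ s → sortDesc (xs ++ s) ≡ foldr insert s xs
sortDesc-++-sorted xs {s} s↘ = trans (foldr-++ insert [] xs s) (cong (λ ys → foldr insert ys xs) (sortDesc-sorted s↘))

get-≤-head : ∀ {x xs} → Linked _≥_ (x ∷ xs) → ∀ i → get (x ∷ xs) i ≤ x
get-≤-head               _           zero    = ≤-refl
get-≤-head {xs = []}     _           (suc i) = z≤n
get-≤-head {xs = y ∷ xs} (x≥y ∷ ys↘) (suc i) = ≤-trans (get-≤-head ys↘ i) x≥y

get-filter-positive : ∀ {xs} → Linked _≥_ xs → ∀ i → get (filter (1 ≤?_) xs) i ≡ get xs i
get-filter-positive {[]}       _   i       = refl
get-filter-positive {suc x ∷ xs} xs↘ zero  = refl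
get-filter-positive {suc x ∷ xs} xs↘ (suc i) = get-filter-positive (Linked.tail xs↘) i
get-filter-positive {zero ∷ xs}  xs↘ i     = begin
  get (filter (1 ≤?_) xs) i ≡⟨ get-filter-positive (Linked.tail xs↘) i ⟩
  get xs i                  ≡⟨ vanishes (suc i) ⟩
  0                         ≡⟨ ≡-sym (vanishes i) ⟩
  get (0 ∷ xs) i            ∎
  where
  open ≡-Reasoning
  vanishes : ∀ j → get (0 ∷ xs) j ≡ 0
  vanishes j = n≤0⇒n≡0 (get-≤-head xs↘ j)

get-beyond : ∀ xs i → length xs ≤ i → get xs i ≡ 0
get-beyond []       i       _         = refl
get-beyond (x ∷ xs) (suc i) (s≤s n≤i) = get-beyond xs i n≤i

count-as-∑ : ∀ t xs → length (filter (t ≤?_) xs) ≡ ∑[ i < length xs ] [ t ≤ᵇ get xs i ]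
count-as-∑ t []       = refl
count-as-∑ t (x ∷ xs) with t ≤ᵇ x
... | true  = cong suc (count-as-∑ t xs)
... | false = count-as-∑ t xs

count-filter-positive : ∀ j xs → length (filter (suc j ≤?_) (filter (1 ≤?_) xs)) ≡ length (filter (suc j ≤?_) xs)
count-filter-positive j []           = refl
count-filter-positive j (zero ∷ xs)  = count-filter-positive j xs
count-filter-positive j (suc x ∷ xs) with j <ᵇ suc x
... | true  = cong suc (count-filter-positive j xs)
... | false = count-filter-positive j xs

count-above-max : ∀ t xs → maxOf xs < t → length (filter (t ≤?_) xs) ≡ 0
count-above-max t []       _     = refl
count-above-max t (x ∷ xs) max<t
  rewrite dec-false (t ≤? x) (<⇒≱ (≤-<-trans (m≤m⊔n x (maxOf xs)) max<t)) =
  count-above-max t xs (≤-<-trans (m≤n⊔m x (maxOf xs)) max<t)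

get-applyUpTo : ∀ (f : ℕ → ℕ) n j → j < n → get (applyUpTo f n) j ≡ f j
get-applyUpTo f (suc n) zero    _         = refl
get-applyUpTo f (suc n) (suc j) (s≤s j<n) = get-applyUpTo (f ∘ suc) n j j<n

get-conj : ∀ xs j → get (conj xs) j ≡ length (filter (suc j ≤?_) xs)
get-conj xs j = trans (cong (λ ys → get ys j) (map-applyUpTo (λ i → i) count (maxOf xs))) get-column
  where
  count : ℕ → ℕ
  count k = length (filter (suc k ≤?_) xs)
  get-column : get (applyUpTo count (maxOf xs)) j ≡ count j
  get-column with j <? maxOf xs
  ... | yes j<max = get-applyUpTo count (maxOf xs) j j<max
  ... | no  j≮max =
    trans (get-beyond (applyUpTo count (maxOf xs)) j (subst (_≤ j) (≡-sym (length-applyUpTo count (maxOf xs))) (≮⇒≥ j≮max)))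
          (≡-sym (count-above-max (suc j) xs (s≤s (≮⇒≥ j≮max))))

get-downFrom : ∀ m t → t < m → get (downFrom m) t ≡ m ∸ suc t
get-downFrom (suc m) zero    _         = refl
get-downFrom (suc m) (suc t) (s≤s t<m) = get-downFrom m t t<m

nPart-δ : ∀ m → nPart (δ m) ≡ ∑[ t < m ] (t * (m ∸ suc t))
nPart-δ m = begin
  Σ< (length (downFrom m)) (λ t → t * get (downFrom m) t) ≡⟨ Σ<≡∑ (length (downFrom m)) _ ⟩
  ∑[ t < length (downFrom m) ] (t * get (downFrom m) t)  ≡⟨ cong (λ n → ∑[ t < n ] (t * get (downFrom m) t)) (length-downFrom m) ⟩
  ∑[ t < m ] (t * get (downFrom m) t)                    ≡⟨ ∑-cong m (λ t t<m → cong (t *_) (get-downFrom m t t<m)) ⟩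
  ∑[ t < m ] (t * (m ∸ suc t))                           ∎
  where open ≡-Reasoning

nPartFrom : ℕ → List ℕ → ℕ
nPartFrom o xs = ∑[ i < length xs ] ((o + i) * get xs i)

nPartFrom-∷ : ∀ o x xs → nPartFrom o (x ∷ xs) ≡ (o + 0) * x + nPartFrom (suc o) xs
nPartFrom-∷ o x xs = cong ((o + 0) * x +_) (∑-cong (length xs) (λ i _ → cong (_* get xs i) (+-suc o i)))

head-above-tail : ∀ {x a} → Linked _>_ (x ∷ a) → All (_< x) a
head-above-tail [-]          = []
head-above-tail (x>y ∷ a↘) = Linked⇒All (λ p q → <-trans q p) x>y a↘

-- The rows of a superpartition diagram

-- A row of the diagram of a superpartition: its length in Λ^* and whether it ends with a circle,
-- so that its width is its length in Λ^⊛.  Rows are listed from the top; a circled row lies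
-- strictly above every other row of its length.
record Row : Set where
  constructor row
  field
    len     : ℕ
    circled : Bool

open Row

width : Row → ℕ
width r = [ circled r ] + len r

record _≽_ (p q : Row) : Set where
  constructor mk≽
  field
    len-≤          : len q ≤ len p
    circled⇒len-< : circled q ≡ true → len q < len p

≽-trans : ∀ {p q r} → p ≽ q → q ≽ r → p ≽ r
≽-trans (mk≽ q≤p q<p) (mk≽ r≤q r<q) = mk≽ (≤-trans r≤q q≤p) (λ r∘ → <-≤-trans (r<q r∘) q≤p)

width-≤ : ∀ {p q} → p ≽ q → width q ≤ len p
width-≤ {q = row _ true}  (mk≽ _ q<p) = q<p refl
width-≤ {q = row _ false} (mk≽ q≤p _) = q≤p

[≤ᵇ-width] : ∀ j r → [ suc j ≤ᵇ width r ] ≡ [ suc j ≤ᵇ len r ] + [ circled r ] * [ len r ≡ᵇ j ]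
[≤ᵇ-width] j (row v false) = ≡-sym (+-identityʳ _)
[≤ᵇ-width] j (row v true) with <-cmp j v
... | tri< j<v _ _ rewrite dec-true (suc j ≤? suc v) (s≤s (<⇒≤ j<v)) | dec-true (suc j ≤? v) j<v
                         | dec-false (v ≟ j) (≢-sym (<⇒≢ j<v)) = refl
... | tri≈ _ refl _ rewrite dec-true (suc j ≤? suc j) ≤-refl | dec-false (suc j ≤? j) (n≮n j)
                          | dec-true (j ≟ j) refl = refl
... | tri> _ _ v<j rewrite dec-false (suc j ≤? suc v) (<⇒≱ (s≤s v<j)) | dec-false (suc j ≤? v) (<⇒≱ (m<n⇒m<1+n v<j))
                         | dec-false (v ≟ j) (<⇒≢ v<j) = refl

emptyRow : Row
emptyRow = row 0 false

plainRow : ℕ → Row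
plainRow y = row y false

rowAt : List Row → ℕ → Row
rowAt []       _       = emptyRow
rowAt (r ∷ _)  zero    = r
rowAt (_ ∷ rs) (suc i) = rowAt rs i

rowAt-beyond : ∀ rs i → length rs ≤ i → rowAt rs i ≡ emptyRow
rowAt-beyond []       i       _         = refl
rowAt-beyond (r ∷ rs) (suc i) (s≤s le) = rowAt-beyond rs i le

get-map : ∀ (f : Row → ℕ) → f emptyRow ≡ 0 → ∀ rs i → get (map f rs) i ≡ f (rowAt rs i)
get-map f f∅ []       i       = ≡-sym f∅
get-map f f∅ (r ∷ rs) zero    = refl
get-map f f∅ (r ∷ rs) (suc i) = get-map f f∅ rs i

count-map : ∀ t (f : Row → ℕ) → f emptyRow ≡ 0 → ∀ rs →
            length (filter (t ≤?_) (map f rs)) ≡ ∑[ i < length rs ] [ t ≤ᵇ f (rowAt rs i) ]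
count-map t f f∅ rs = begin
  length (filter (t ≤?_) (map f rs))                    ≡⟨ count-as-∑ t (map f rs) ⟩
  ∑[ i < length (map f rs) ] [ t ≤ᵇ get (map f rs) i ] ≡⟨ cong (λ n → ∑[ i < n ] [ t ≤ᵇ get (map f rs) i ]) (length-map f rs) ⟩
  ∑[ i < length rs ] [ t ≤ᵇ get (map f rs) i ]         ≡⟨ ∑-cong (length rs) (λ i _ → cong (λ v → [ t ≤ᵇ v ]) (get-map f f∅ rs i)) ⟩
  ∑[ i < length rs ] [ t ≤ᵇ f (rowAt rs i) ]           ∎
  where open ≡-Reasoning

≽-empty : ∀ r → r ≽ emptyRow
≽-empty r = mk≽ z≤n (λ ())

head-≽-rowAt : ∀ {r rs} → Linked _≽_ (r ∷ rs) → ∀ i → r ≽ rowAt rs i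
head-≽-rowAt {r} {[]}     _           i       = ≽-empty r
head-≽-rowAt {r} {q ∷ rs} (r≽q ∷ _)   zero    = r≽q
head-≽-rowAt {r} {q ∷ rs} (r≽q ∷ ord) (suc i) = ≽-trans r≽q (head-≽-rowAt ord i)

rowAt-≽ : ∀ {rs} → Linked _≽_ rs → ∀ {k i} → k < i → rowAt rs k ≽ rowAt rs i
rowAt-≽ {[]}     _   {k} {i} _         = ≽-empty emptyRow
rowAt-≽ {r ∷ rs} ord {zero}  {suc i} _         = head-≽-rowAt ord i
rowAt-≽ {r ∷ rs} ord {suc k} {suc i} (s≤s k<i) = rowAt-≽ (Linked.tail ord) k<i

CircledShorter : ℕ → List Row → Set
CircledShorter z = All (λ r → circled r ≡ true → len r < z)

insertCircled : ℕ → List Row → List Row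
insertCircled x []       = row x true ∷ []
insertCircled x (r ∷ rs) = if len r ≤ᵇ x then row x true ∷ r ∷ rs else r ∷ insertCircled x rs

rowsOf : List ℕ → List ℕ → List Row
rowsOf a s = foldr insertCircled (map plainRow s) a

rows : SuperPartition → List Row
rows Λ = rowsOf (anti Λ) (symmetric Λ)

map-len-insertCircled : ∀ x rs → map len (insertCircled x rs) ≡ insert x (map len rs)
map-len-insertCircled x []       = refl
map-len-insertCircled x (r ∷ rs) with len r ≤ᵇ x
... | true  = refl
... | false = cong (len r ∷_) (map-len-insertCircled x rs)

map-len-rowsOf : ∀ a s → map len (rowsOf a s) ≡ foldr insert s a
map-len-rowsOf []      s = trans (≡-sym (map-∘ s)) (map-id s)
map-len-rowsOf (x ∷ a) s = trans (map-len-insertCircled x (rowsOf a s)) (cong (insert x) (map-len-rowsOf a s))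

insertCircled-circledShorter : ∀ {x z} rs → x < z → CircledShorter z rs → CircledShorter z (insertCircled x rs)
insertCircled-circledShorter []       x<z _             = (λ _ → x<z) ∷ []
insertCircled-circledShorter {x} (r ∷ rs) x<z (r<z ∷ sh) with len r ≤ᵇ x
... | true  = (λ _ → x<z) ∷ r<z ∷ sh
... | false = r<z ∷ insertCircled-circledShorter rs x<z sh

rowsOf-circledShorter : ∀ {z} a s → All (_< z) a → CircledShorter z (rowsOf a s)
rowsOf-circledShorter []      s []           = map⁺ (universal (λ _ ()) s)
rowsOf-circledShorter (x ∷ a) s (x<z ∷ a<z) =
  insertCircled-circledShorter (rowsOf a s) x<z (rowsOf-circledShorter a s a<z)

insertCircled-ordered′ : ∀ x {p} rs → p ≽ row x true → Linked _≽_ (p ∷ rs) → CircledShorter x rs →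
                         Linked _≽_ (p ∷ insertCircled x rs)
insertCircled-ordered′ x []       p≽x _           _          = p≽x ∷ [-]
insertCircled-ordered′ x (r ∷ rs) p≽x (p≽r ∷ ord) (r<x ∷ sh) with len r ≤ᵇ x in eq
... | true  = p≽x ∷ mk≽ (≤ᵇ≡true⇒≤ eq) r<x ∷ ord
... | false = p≽r ∷ insertCircled-ordered′ x rs (mk≽ (<⇒≤ x<r) (λ _ → x<r)) ord sh
  where x<r = ≤ᵇ≡false⇒> eq

insertCircled-ordered : ∀ x rs → Linked _≽_ rs → CircledShorter x rs → Linked _≽_ (insertCircled x rs)
insertCircled-ordered x []       _   _          = [-]
insertCircled-ordered x (r ∷ rs) ord (r<x ∷ sh) with len r ≤ᵇ x in eq
... | true  = mk≽ (≤ᵇ≡true⇒≤ eq) r<x ∷ ord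
... | false = insertCircled-ordered′ x rs (mk≽ (<⇒≤ x<r) (λ _ → x<r)) ord sh
  where x<r = ≤ᵇ≡false⇒> eq

rowsOf-ordered : ∀ a s → Linked _>_ a → Linked _≥_ s → Linked _≽_ (rowsOf a s)
rowsOf-ordered []      s _  s↘ = Linked-map⁺ (Linked.map (λ y≥z → mk≽ y≥z (λ ())) s↘)
rowsOf-ordered (x ∷ a) s a↘ s↘ =
  insertCircled-ordered x (rowsOf a s) (rowsOf-ordered a s (Linked.tail a↘) s↘)
                        (rowsOf-circledShorter a s (head-above-tail a↘))

insert-widths-below : ∀ {r rs} → Linked _≽_ (r ∷ rs) → insert (len r) (map width rs) ≡ len r ∷ map width rs
insert-widths-below {rs = []}     _         = refl
insert-widths-below {rs = q ∷ rs} (r≽q ∷ _) = insert-≥ (map width rs) (width-≤ r≽q)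

insert-suc-widths : ∀ x rs → Linked _≽_ rs → CircledShorter x rs →
                    insert (suc x) (map width rs) ≡ map width (insertCircled x rs)
insert-suc-widths x []                ord         sh          = refl
insert-suc-widths x (row v true ∷ rs) ord         (v<x ∷ sh) with v ≤ᵇ x in eq
... | true  = insert-≥ (map width rs) (s≤s (≤ᵇ≡true⇒≤ eq))
... | false = contradiction (v<x refl) (<⇒≯ (≤ᵇ≡false⇒> eq))
insert-suc-widths x (row v false ∷ rs) ord        (_ ∷ sh) with v ≤ᵇ x in eq
... | true  = insert-≥ (map width rs) (m≤n⇒m≤1+n (≤ᵇ≡true⇒≤ eq))
... | false with m≤n⇒m<n∨m≡n (≤ᵇ≡false⇒> eq)
...   | inj₁ 1+x<v = trans (insert-< (map width rs) 1+x<v)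
                           (cong (v ∷_) (insert-suc-widths x rs (Linked.tail ord) sh))
...   | inj₂ refl  = begin
  insert v (v ∷ map width rs)              ≡⟨ insert-≥ (map width rs) ≤-refl ⟩
  v ∷ v ∷ map width rs                     ≡⟨ cong (v ∷_) (insert-widths-below ord) ⟨
  v ∷ insert v (map width rs)              ≡⟨ cong (v ∷_) (insert-suc-widths x rs (Linked.tail ord) sh) ⟩
  v ∷ map width (insertCircled x rs)       ∎
  where open ≡-Reasoning

map-width-rowsOf : ∀ a s → Linked _>_ a → Linked _≥_ s → map width (rowsOf a s) ≡ foldr insert s (map suc a)
map-width-rowsOf []      s _  _  = trans (≡-sym (map-∘ s)) (map-id s)
map-width-rowsOf (x ∷ a) s a↘ s↘ = begin
  map width (insertCircled x (rowsOf a s))    ≡⟨ insert-suc-widths x (rowsOf a s) (rowsOf-ordered a s (Linked.tail a↘) s↘)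
                                                  (rowsOf-circledShorter a s (head-above-tail a↘)) ⟨
  insert (suc x) (map width (rowsOf a s))     ≡⟨ cong (insert (suc x)) (map-width-rowsOf a s (Linked.tail a↘) s↘) ⟩
  insert (suc x) (foldr insert s (map suc a)) ∎
  where open ≡-Reasoning

rowsOf-width-positive : ∀ a s → All (_> 0) s → All (λ r → width r > 0) (rowsOf a s)
rowsOf-width-positive []      s s>0 = map⁺ s>0
rowsOf-width-positive (x ∷ a) s s>0 = insert-positive (rowsOf a s) (rowsOf-width-positive a s s>0)
  where
  insert-positive : ∀ rs → All (λ r → width r > 0) rs → All (λ r → width r > 0) (insertCircled x rs)
  insert-positive []       _           = s≤s z≤n ∷ []
  insert-positive (r ∷ rs) (r>0 ∷ rs>0) with len r ≤ᵇ x
  ... | true  = s≤s z≤n ∷ r>0 ∷ rs>0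
  ... | false = r>0 ∷ insert-positive rs rs>0

circledLens : List Row → List ℕ
circledLens []                 = []
circledLens (row v true  ∷ rs) = v ∷ circledLens rs
circledLens (row v false ∷ rs) = circledLens rs

circledLens-insertCircled : ∀ x rs → CircledShorter x rs → circledLens (insertCircled x rs) ≡ x ∷ circledLens rs
circledLens-insertCircled x []                 _           = refl
circledLens-insertCircled x (row v b ∷ rs) (v<x ∷ sh) with v ≤ᵇ x in eq | b
... | true  | _     = refl
... | false | true  = contradiction (v<x refl) (<⇒≯ (≤ᵇ≡false⇒> eq))
... | false | false = circledLens-insertCircled x rs sh

circledLens-rowsOf : ∀ a s → Linked _>_ a → circledLens (rowsOf a s) ≡ a
circledLens-rowsOf []      []      _  = refl
circledLens-rowsOf []      (y ∷ s) _  = circledLens-rowsOf [] s []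
circledLens-rowsOf (x ∷ a) s       a↘ =
  trans (circledLens-insertCircled x (rowsOf a s) (rowsOf-circledShorter a s (head-above-tail a↘)))
        (cong (x ∷_) (circledLens-rowsOf a s (Linked.tail a↘)))

length-circledLens : ∀ rs → length (circledLens rs) ≡ ∑[ j < length rs ] [ circled (rowAt rs j) ]
length-circledLens []                  = refl
length-circledLens (row v true  ∷ rs) = cong suc (length-circledLens rs)
length-circledLens (row v false ∷ rs) = length-circledLens rs

nPartFrom-circledLens : ∀ o rs →
  nPartFrom o (circledLens rs) ≡
  ∑[ j < length rs ] ([ circled (rowAt rs j) ] * ((o + ∑[ k < j ] [ circled (rowAt rs k) ]) * len (rowAt rs j)))
nPartFrom-circledLens o []                  = refl
nPartFrom-circledLens o (row v false ∷ rs) = nPartFrom-circledLens o rs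
nPartFrom-circledLens o (row v true  ∷ rs) =
  trans (nPartFrom-∷ o v (circledLens rs))
        (cong₂ _+_ (≡-sym (+-identityʳ _))
               (trans (nPartFrom-circledLens (suc o) rs)
                      (∑-cong (length rs) (λ j _ → cong (λ z → [ circled (rowAt rs j) ] * (z * len (rowAt rs j)))
                                                         (≡-sym (+-suc o _))))))

module Diagram {Λ : SuperPartition} (valid : IsSuperPartition Λ) where

  private
    a↘ : Linked _>_ (anti Λ)
    a↘ = proj₁ valid
    s↘ : Linked _≥_ (symmetric Λ)
    s↘ = proj₁ (proj₂ valid)
    s>0 : All (_> 0) (symmetric Λ)
    s>0 = proj₂ (proj₂ valid)

  ordered : Linked _≽_ (rows Λ)
  ordered = rowsOf-ordered (anti Λ) (symmetric Λ) a↘ s↘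

  anti≡circledLens : anti Λ ≡ circledLens (rows Λ)
  anti≡circledLens = ≡-sym (circledLens-rowsOf (anti Λ) (symmetric Λ) a↘)

  star≡filter-lens : star Λ ≡ filter (1 ≤?_) (map len (rows Λ))
  star≡filter-lens = cong (filter (1 ≤?_))
    (trans (sortDesc-++-sorted (anti Λ) s↘) (≡-sym (map-len-rowsOf (anti Λ) (symmetric Λ))))

  circ≡widths : circ Λ ≡ map width (rows Λ)
  circ≡widths = begin
    filter (1 ≤?_) (sortDesc (map suc (anti Λ) ++ symmetric Λ))
      ≡⟨ cong (filter (1 ≤?_)) (sortDesc-++-sorted (map suc (anti Λ)) s↘) ⟩
    filter (1 ≤?_) (foldr insert (symmetric Λ) (map suc (anti Λ)))
      ≡⟨ cong (filter (1 ≤?_)) (map-width-rowsOf (anti Λ) (symmetric Λ) a↘ s↘) ⟨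
    filter (1 ≤?_) (map width (rows Λ))
      ≡⟨ filter-all (1 ≤?_) (map⁺ (rowsOf-width-positive (anti Λ) (symmetric Λ) s>0)) ⟩
    map width (rows Λ) ∎
    where open ≡-Reasoning

  get-star : ∀ i → get (star Λ) i ≡ len (rowAt (rows Λ) i)
  get-star i = begin
    get (star Λ) i                              ≡⟨ cong (λ xs → get xs i) star≡filter-lens ⟩
    get (filter (1 ≤?_) (map len (rows Λ))) i  ≡⟨ get-filter-positive (Linked-map⁺ (Linked.map _≽_.len-≤ ordered)) i ⟩
    get (map len (rows Λ)) i                    ≡⟨ get-map len refl (rows Λ) i ⟩
    len (rowAt (rows Λ) i)                      ∎
    where open ≡-Reasoning

  get-circ : ∀ i → get (circ Λ) i ≡ width (rowAt (rows Λ) i)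
  get-circ i = trans (cong (λ xs → get xs i) circ≡widths) (get-map width refl (rows Λ) i)

  rowCirc≡circled : ∀ i → rowCirc Λ i ≡ circled (rowAt (rows Λ) i)
  rowCirc≡circled i = trans (cong₂ (λ c s → not (c ≡ᵇ s)) (get-circ i) (get-star i)) (circled-iff-wider (rowAt (rows Λ) i))
    where
    circled-iff-wider : ∀ r → not (width r ≡ᵇ len r) ≡ circled r
    circled-iff-wider (row v true)  = cong not (dec-false (suc v ≟ v) 1+n≢n)
    circled-iff-wider (row v false) = cong not (dec-true (v ≟ v) refl)

  length-circ : length (circ Λ) ≡ length (rows Λ)
  length-circ = trans (cong length circ≡widths) (length-map width (rows Λ))

  fermDeg≡#circled : fermDeg Λ ≡ ∑[ i < length (rows Λ) ] [ circled (rowAt (rows Λ) i) ]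
  fermDeg≡#circled = trans (cong length anti≡circledLens) (length-circledLens (rows Λ))

  length-star-≤ : length (star Λ) ≤ length (rows Λ)
  length-star-≤ = subst (_≤ length (rows Λ)) (≡-sym (cong length star≡filter-lens))
    (≤-trans (length-filter (1 ≤?_) (map len (rows Λ))) (≤-reflexive (length-map len (rows Λ))))

  get-conj-star : ∀ j → get (conj (star Λ)) j ≡ ∑[ i < length (rows Λ) ] [ suc j ≤ᵇ len (rowAt (rows Λ) i) ]
  get-conj-star j = begin
    get (conj (star Λ)) j                                       ≡⟨ get-conj (star Λ) j ⟩
    length (filter (suc j ≤?_) (star Λ))                        ≡⟨ cong (λ xs → length (filter (suc j ≤?_) xs)) star≡filter-lens ⟩
    length (filter (suc j ≤?_) (filter (1 ≤?_) (map len (rows Λ)))) ≡⟨ count-filter-positive j (map len (rows Λ)) ⟩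
    length (filter (suc j ≤?_) (map len (rows Λ)))              ≡⟨ count-map (suc j) len refl (rows Λ) ⟩
    ∑[ i < length (rows Λ) ] [ suc j ≤ᵇ len (rowAt (rows Λ) i) ] ∎
    where open ≡-Reasoning

  get-conj-circ : ∀ j → get (conj (circ Λ)) j ≡ ∑[ i < length (rows Λ) ] [ suc j ≤ᵇ width (rowAt (rows Λ) i) ]
  get-conj-circ j = begin
    get (conj (circ Λ)) j                          ≡⟨ get-conj (circ Λ) j ⟩
    length (filter (suc j ≤?_) (circ Λ))           ≡⟨ cong (λ xs → length (filter (suc j ≤?_) xs)) circ≡widths ⟩
    length (filter (suc j ≤?_) (map width (rows Λ))) ≡⟨ count-map (suc j) width refl (rows Λ) ⟩
    ∑[ i < length (rows Λ) ] [ suc j ≤ᵇ width (rowAt (rows Λ) i) ] ∎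
    where open ≡-Reasoning

module Counting (rs : List Row) (ordered : Linked _≽_ rs) where

  L : ℕ
  L = length rs

  ℓ : ℕ → ℕ
  ℓ i = len (rowAt rs i)

  c : ℕ → Bool
  c i = circled (rowAt rs i)

  #circled : ℕ
  #circled = ∑[ i < L ] [ c i ]

  #circledAbove : ℕ → ℕ
  #circledAbove i = ∑[ k < i ] [ c k ]

  #plainAbove : ℕ → ℕ
  #plainAbove i = ∑[ k < i ] [ not (c k) ]

  #longerThan : ℕ → ℕ
  #longerThan j = ∑[ i < L ] [ suc j ≤ᵇ ℓ i ]

  #circledShorterThan : ℕ → ℕ
  #circledShorterThan t = ∑[ i < L ] ([ c i ] * [ ℓ i <ᵇ t ])

  #circledOfLength : ℕ → ℕ
  #circledOfLength j = ∑[ i < L ] ([ c i ] * [ ℓ i ≡ᵇ j ])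

  ℓ-antitone : ∀ {k i} → k ≤ i → ℓ i ≤ ℓ k
  ℓ-antitone k≤i with m≤n⇒m<n∨m≡n k≤i
  ... | inj₁ k<i  = _≽_.len-≤ (rowAt-≽ ordered k<i)
  ... | inj₂ refl = ≤-refl

  ℓ-circled-< : ∀ {k i} → c i ≡ true → k < i → ℓ i < ℓ k
  ℓ-circled-< ci k<i = _≽_.circled⇒len-< (rowAt-≽ ordered k<i) ci

  circled⇒< : ∀ {i} → c i ≡ true → i < L
  circled⇒< {i} ci with i <? L
  ... | yes i<L = i<L
  ... | no  i≮L with () ← trans (≡-sym (cong circled (rowAt-beyond rs i (≮⇒≥ i≮L)))) ci

  circled-ℓ-injective : ∀ {a b} → c a ≡ true → c b ≡ true → ℓ a ≡ ℓ b → a ≡ b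
  circled-ℓ-injective {a} {b} ca cb ℓa≡ℓb with <-cmp a b
  ... | tri< a<b _ _ = contradiction (≡-sym ℓa≡ℓb) (<⇒≢ (ℓ-circled-< cb a<b))
  ... | tri≈ _ a≡b _ = a≡b
  ... | tri> _ _ b<a = contradiction ℓa≡ℓb (<⇒≢ (ℓ-circled-< ca b<a))

  #longerThan-circled : ∀ {i} → c i ≡ true → #longerThan (ℓ i) ≡ i
  #longerThan-circled {i} ci = begin
    ∑[ k < L ] [ suc (ℓ i) ≤ᵇ ℓ k ] ≡⟨ ∑-cong L (λ k _ → longer⇔above k) ⟩
    ∑[ k < L ] (1 * [ k <ᵇ i ])     ≡⟨ ∑-truncate i L (λ _ → 1) (<⇒≤ (circled⇒< ci)) ⟩
    ∑[ _ < i ] 1                     ≡⟨ ∑-one i ⟩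
    i                                ∎
    where
    open ≡-Reasoning
    longer⇔above : ∀ k → [ suc (ℓ i) ≤ᵇ ℓ k ] ≡ 1 * [ k <ᵇ i ]
    longer⇔above k with k <? i
    ... | yes k<i rewrite dec-true (suc (ℓ i) ≤? ℓ k) (ℓ-circled-< ci k<i) | dec-true (k <? i) k<i = refl
    ... | no  k≮i rewrite dec-false (suc (ℓ i) ≤? ℓ k) (≤⇒≯ (ℓ-antitone (≮⇒≥ k≮i)))
                        | dec-false (k <? i) k≮i = refl

  -- Every circled row is either shorter than the circled row i, or lies at or above it.
  #circledShorterThan-circled : ∀ {i} → c i ≡ true → #circledShorterThan (ℓ i) + suc (#circledAbove i) ≡ #circled
  #circledShorterThan-circled {i} ci = begin
    #circledShorterThan (ℓ i) + suc (#circledAbove i)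
      ≡⟨ cong₂ _+_ (∑-cong L (λ k _ → shorter⇔below k)) atOrAbove ⟩
    ∑[ k < L ] ([ c k ] * [ i <ᵇ k ]) + ∑[ k < L ] ([ c k ] * [ k <ᵇ suc i ])
      ≡⟨ ∑-+ L _ _ ⟨
    ∑[ k < L ] ([ c k ] * [ i <ᵇ k ] + [ c k ] * [ k <ᵇ suc i ])
      ≡⟨ ∑-cong L (λ k _ → below-or-not k) ⟩
    #circled ∎
    where
    open ≡-Reasoning
    shorter⇔below : ∀ k → [ c k ] * [ ℓ k <ᵇ ℓ i ] ≡ [ c k ] * [ i <ᵇ k ]
    shorter⇔below k with c k in ck
    ... | false = refl
    ... | true with i <? k
    ...   | yes i<k rewrite dec-true (ℓ k <? ℓ i) (ℓ-circled-< ck i<k) | dec-true (i <? k) i<k = refl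
    ...   | no  i≮k rewrite dec-false (ℓ k <? ℓ i) (≤⇒≯ (ℓ-antitone (≮⇒≥ i≮k)))
                          | dec-false (i <? k) i≮k = refl
    atOrAbove : suc (#circledAbove i) ≡ ∑[ k < L ] ([ c k ] * [ k <ᵇ suc i ])
    atOrAbove = ≡-sym (begin
      ∑[ k < L ] ([ c k ] * [ k <ᵇ suc i ]) ≡⟨ ∑-truncate (suc i) L (λ k → [ c k ]) (circled⇒< ci) ⟩
      ∑[ k < suc i ] [ c k ]                ≡⟨ ∑-suc i (λ k → [ c k ]) ⟩
      #circledAbove i + [ c i ]             ≡⟨ cong (λ b → #circledAbove i + [ b ]) ci ⟩
      #circledAbove i + 1                   ≡⟨ +-comm _ 1 ⟩
      suc (#circledAbove i)                 ∎)
    below-or-not : ∀ k → [ c k ] * [ i <ᵇ k ] + [ c k ] * [ k <ᵇ suc i ] ≡ [ c k ]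
    below-or-not k = begin
      [ c k ] * [ i <ᵇ k ] + [ c k ] * [ k <ᵇ suc i ] ≡⟨ *-distribˡ-+ [ c k ] _ _ ⟨
      [ c k ] * ([ i <ᵇ k ] + [ k <ᵇ suc i ])         ≡⟨ cong (λ b → [ c k ] * ([ i <ᵇ k ] + [ b ])) (<ᵇ-suc-not i k) ⟩
      [ c k ] * ([ i <ᵇ k ] + [ not (i <ᵇ k) ])       ≡⟨ cong ([ c k ] *_) (trans (+-comm [ i <ᵇ k ] _) ([]-not (i <ᵇ k))) ⟩
      [ c k ] * 1                                     ≡⟨ *-identityʳ _ ⟩
      [ c k ]                                         ∎

  ∑-#circledOfLength : ∀ j → ∑[ k < j ] #circledOfLength k ≡ #circledShorterThan j
  ∑-#circledOfLength j = begin
    ∑[ k < j ] ∑[ i < L ] ([ c i ] * [ ℓ i ≡ᵇ k ]) ≡⟨ ∑-comm j L (λ i k → [ c i ] * [ ℓ i ≡ᵇ k ]) ⟩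
    ∑[ i < L ] ∑[ k < j ] ([ c i ] * [ ℓ i ≡ᵇ k ]) ≡⟨ ∑-cong L (λ i _ → ∑-*ˡ j [ c i ] _) ⟩
    ∑[ i < L ] ([ c i ] * ∑[ k < j ] [ ℓ i ≡ᵇ k ]) ≡⟨ ∑-cong L (λ i _ → cong ([ c i ] *_) (∑-[≡ᵇ] j (ℓ i))) ⟩
    #circledShorterThan j                           ∎
    where open ≡-Reasoning

  ∑-circledOfLength : ∀ N (h : ℕ → ℕ) → (∀ i → ℓ i < N) →
                      ∑[ j < N ] (#circledOfLength j * h j) ≡ ∑[ i < L ] ([ c i ] * h (ℓ i))
  ∑-circledOfLength N h ℓ<N = begin
    ∑[ j < N ] (∑[ i < L ] ([ c i ] * [ ℓ i ≡ᵇ j ]) * h j) ≡⟨ ∑-cong N (λ j _ → ∑-*ʳ L (h j) _) ⟨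
    ∑[ j < N ] ∑[ i < L ] ([ c i ] * [ ℓ i ≡ᵇ j ] * h j)   ≡⟨ ∑-comm N L (λ i j → [ c i ] * [ ℓ i ≡ᵇ j ] * h j) ⟩
    ∑[ i < L ] ∑[ j < N ] ([ c i ] * [ ℓ i ≡ᵇ j ] * h j)   ≡⟨ ∑-cong L (λ i _ → ∑-cong N (λ j _ → *-assoc [ c i ] _ _)) ⟩
    ∑[ i < L ] ∑[ j < N ] ([ c i ] * ([ ℓ i ≡ᵇ j ] * h j)) ≡⟨ ∑-cong L (λ i _ → ∑-*ˡ N [ c i ] _) ⟩
    ∑[ i < L ] ([ c i ] * ∑[ j < N ] ([ ℓ i ≡ᵇ j ] * h j)) ≡⟨ ∑-cong L (λ i _ → cong ([ c i ] *_) (∑-δ N (ℓ i) h)) ⟩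
    ∑[ i < L ] ([ c i ] * ([ ℓ i <ᵇ N ] * h (ℓ i)))       ≡⟨ ∑-cong L (λ i _ → cong (λ b → [ c i ] * ([ b ] * h (ℓ i))) (dec-true (ℓ i <? N) (ℓ<N i))) ⟩
    ∑[ i < L ] ([ c i ] * (1 * h (ℓ i)))                  ≡⟨ ∑-cong L (λ i _ → cong ([ c i ] *_) (*-identityˡ (h (ℓ i)))) ⟩
    ∑[ i < L ] ([ c i ] * h (ℓ i))                        ∎
    where open ≡-Reasoning

  ∑-circled-rowsAbove : ∀ (f : ℕ → ℕ) →
    ∑[ i < L ] ([ c i ] * (#plainAbove i * f i)) + ∑[ i < L ] ([ c i ] * (#circledAbove i * f i)) ≡
    ∑[ i < L ] ([ c i ] * (i * f i))
  ∑-circled-rowsAbove f = trans (≡-sym (∑-+ L _ _)) (∑-cong L (λ i _ → rowsAbove i))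
    where
    open ≡-Reasoning
    rowsAbove : ∀ i → [ c i ] * (#plainAbove i * f i) + [ c i ] * (#circledAbove i * f i) ≡ [ c i ] * (i * f i)
    rowsAbove i = begin
      [ c i ] * (#plainAbove i * f i) + [ c i ] * (#circledAbove i * f i) ≡⟨ *-distribˡ-+ [ c i ] _ _ ⟨
      [ c i ] * (#plainAbove i * f i + #circledAbove i * f i)             ≡⟨ cong ([ c i ] *_) (*-distribʳ-+ (f i) (#plainAbove i) (#circledAbove i)) ⟨
      [ c i ] * ((#plainAbove i + #circledAbove i) * f i)                 ≡⟨ cong (λ n → [ c i ] * (n * f i)) (∑-[not]+∑-[] c i) ⟩
      [ c i ] * (i * f i)                                                 ∎

  nPart-δ-#circled : nPart (δ #circled) ≡ ∑[ i < L ] ([ c i ] * (#circledAbove i * #circledShorterThan (ℓ i)))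
  nPart-δ-#circled = begin
    nPart (δ #circled)                                                  ≡⟨ nPart-δ #circled ⟩
    ∑[ t < #circled ] (t * (#circled ∸ suc t))                          ≡⟨ ∑-rank c L (λ t → t * (#circled ∸ suc t)) ⟨
    ∑[ i < L ] ([ c i ] * (#circledAbove i * (#circled ∸ suc (#circledAbove i)))) ≡⟨ ∑-cong L (λ i _ → shorter i) ⟩
    ∑[ i < L ] ([ c i ] * (#circledAbove i * #circledShorterThan (ℓ i))) ∎
    where
    open ≡-Reasoning
    shorter : ∀ i → [ c i ] * (#circledAbove i * (#circled ∸ suc (#circledAbove i))) ≡
                    [ c i ] * (#circledAbove i * #circledShorterThan (ℓ i))
    shorter i with c i in ci
    ... | false = refl
    ... | true  = cong (λ n → 1 * (#circledAbove i * n))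
                       (trans (cong (_∸ suc (#circledAbove i)) (≡-sym (#circledShorterThan-circled ci)))
                              (m+n∸n≡m (#circledShorterThan (ℓ i)) (suc (#circledAbove i))))

-- The three statistics

module Fermionic {Λ : SuperPartition} (valid : IsSuperPartition Λ) where

  open Diagram valid
  open Counting (rows Λ) ordered

  plainLongerAbove : ℕ → ℕ → ℕ
  plainLongerAbove i j = ∑[ k < i ] [ not (rowCirc Λ k) ∧ (suc j ≤ᵇ get (star Λ) k) ]

  ζ-row : ℕ → ℕ
  ζ-row i = ∑[ j < get (star Λ) i ] ([ rowCirc Λ i ∧ colCirc Λ (suc j) ] * plainLongerAbove i j)

  ζ≡∑ζ-row : ζ Λ ≡ ∑[ i < length (star Λ) ] ζ-row i
  ζ≡∑ζ-row = trans (Σ<≡∑ (length (star Λ)) _) (∑-cong (length (star Λ)) λ i _ →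
               trans (Σ<≡∑ (get (star Λ) i) _) (∑-cong (get (star Λ) i) λ j _ →
                 cong ([ rowCirc Λ i ∧ colCirc Λ (suc j) ] *_) (Σ<≡∑ i _)))

  [colCirc] : ∀ j → [ colCirc Λ (suc j) ] ≡ #circledOfLength j
  [colCirc] j = begin
    [ any circleAt (upTo (length (circ Λ))) ] ≡⟨ cong (λ n → [ any circleAt (upTo n) ]) length-circ ⟩
    [ any circleAt (upTo L) ]                 ≡⟨ [any]≡∑ L circleAt unique ⟩
    ∑[ i < L ] [ circleAt i ]                 ≡⟨ ∑-cong L (λ i _ → trans (cong [_] (circleAt≡ i)) ([]-∧ (c i) _)) ⟩
    #circledOfLength j                        ∎
    where
    open ≡-Reasoning
    circleAt : ℕ → Bool
    circleAt i = rowCirc Λ i ∧ (get (circ Λ) i ≡ᵇ suc j)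
    circleAt≡ : ∀ i → circleAt i ≡ (c i ∧ (ℓ i ≡ᵇ j))
    circleAt≡ i = trans (cong₂ (λ b w → b ∧ (w ≡ᵇ suc j)) (rowCirc≡circled i) (get-circ i))
                        (circled-width (rowAt (rows Λ) i))
      where
      circled-width : ∀ r → (circled r ∧ (width r ≡ᵇ suc j)) ≡ (circled r ∧ (len r ≡ᵇ j))
      circled-width (row v true)  = refl
      circled-width (row v false) = refl
    unique : ∀ a b → circleAt a ≡ true → circleAt b ≡ true → a ≡ b
    unique a b at-a at-b = circled-ℓ-injective (∧-conicalˡ _ _ at-a′) (∧-conicalˡ _ _ at-b′)
      (trans (≡ᵇ≡true⇒≡ (∧-conicalʳ _ _ at-a′)) (≡-sym (≡ᵇ≡true⇒≡ (∧-conicalʳ _ _ at-b′))))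
      where
      at-a′ = trans (≡-sym (circleAt≡ a)) at-a
      at-b′ = trans (≡-sym (circleAt≡ b)) at-b

  -- A row above a row longer than j is itself longer than j.
  plainLongerAbove≡#plainAbove : ∀ i j → j < ℓ i → plainLongerAbove i j ≡ #plainAbove i
  plainLongerAbove≡#plainAbove i j j<ℓi = ∑-cong i λ k k<i → cong [_] (begin
    not (rowCirc Λ k) ∧ (suc j ≤ᵇ get (star Λ) k) ≡⟨ cong₂ (λ b v → not b ∧ (suc j ≤ᵇ v)) (rowCirc≡circled k) (get-star k) ⟩
    not (c k) ∧ (suc j ≤ᵇ ℓ k)                    ≡⟨ cong (not (c k) ∧_) (dec-true (suc j ≤? ℓ k) (≤-trans j<ℓi (ℓ-antitone (<⇒≤ k<i)))) ⟩
    not (c k) ∧ true                              ≡⟨ ∧-identityʳ _ ⟩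
    not (c k)                                     ∎)
    where open ≡-Reasoning

  ζ-row≡ : ∀ i → ζ-row i ≡ [ c i ] * (#plainAbove i * #circledShorterThan (ℓ i))
  ζ-row≡ i = begin
    ζ-row i
      ≡⟨ cong (λ n → ∑[ j < n ] ([ rowCirc Λ i ∧ colCirc Λ (suc j) ] * plainLongerAbove i j)) (get-star i) ⟩
    ∑[ j < ℓ i ] ([ rowCirc Λ i ∧ colCirc Λ (suc j) ] * plainLongerAbove i j)
      ≡⟨ ∑-cong (ℓ i) (λ j j<ℓi → cong₂ _*_ (fermionic j) (plainLongerAbove≡#plainAbove i j j<ℓi)) ⟩
    ∑[ j < ℓ i ] ([ c i ] * #circledOfLength j * #plainAbove i)
      ≡⟨ ∑-*ʳ (ℓ i) (#plainAbove i) _ ⟩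
    ∑[ j < ℓ i ] ([ c i ] * #circledOfLength j) * #plainAbove i
      ≡⟨ cong (_* #plainAbove i) (trans (∑-*ˡ (ℓ i) [ c i ] _) (cong ([ c i ] *_) (∑-#circledOfLength (ℓ i)))) ⟩
    [ c i ] * #circledShorterThan (ℓ i) * #plainAbove i
      ≡⟨ trans (*-assoc [ c i ] _ _) (cong ([ c i ] *_) (*-comm _ (#plainAbove i))) ⟩
    [ c i ] * (#plainAbove i * #circledShorterThan (ℓ i)) ∎
    where
    open ≡-Reasoning
    fermionic : ∀ j → [ rowCirc Λ i ∧ colCirc Λ (suc j) ] ≡ [ c i ] * #circledOfLength j
    fermionic j = trans ([]-∧ (rowCirc Λ i) _) (cong₂ _*_ (cong [_] (rowCirc≡circled i)) ([colCirc] j))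

  ζ-as-∑ : ζ Λ ≡ ∑[ i < L ] ([ c i ] * (#plainAbove i * #circledShorterThan (ℓ i)))
  ζ-as-∑ = begin
    ζ Λ                              ≡⟨ ζ≡∑ζ-row ⟩
    ∑[ i < length (star Λ) ] ζ-row i ≡⟨ ∑-extend (length (star Λ)) L ζ-row length-star-≤ empty-row ⟩
    ∑[ i < L ] ζ-row i               ≡⟨ ∑-cong L (λ i _ → ζ-row≡ i) ⟩
    ∑[ i < L ] ([ c i ] * (#plainAbove i * #circledShorterThan (ℓ i))) ∎
    where
    open ≡-Reasoning
    empty-row : ∀ i → length (star Λ) ≤ i → i < L → ζ-row i ≡ 0
    empty-row i star≤i _ =
      cong (λ n → ∑[ j < n ] ([ rowCirc Λ i ∧ colCirc Λ (suc j) ] * plainLongerAbove i j)) (get-beyond (star Λ) i star≤i)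

module Conjugate {Λ Λ' : SuperPartition} (valid : IsSuperPartition Λ) (valid' : IsSuperPartition Λ')
                 (star-conj : star Λ' ≡ conj (star Λ)) (circ-conj : circ Λ' ≡ conj (circ Λ)) where

  open Diagram valid using (ordered; get-conj-star; get-conj-circ)
  open Counting (rows Λ) ordered
  module D′ = Diagram valid'
  module C′ = Counting (rows Λ') D′.ordered

  ℓ′≡#longerThan : ∀ j → C′.ℓ j ≡ #longerThan j
  ℓ′≡#longerThan j = begin
    C′.ℓ j                  ≡⟨ D′.get-star j ⟨
    get (star Λ') j         ≡⟨ cong (λ xs → get xs j) star-conj ⟩
    get (conj (star Λ)) j   ≡⟨ get-conj-star j ⟩
    #longerThan j           ∎
    where open ≡-Reasoning

  [c′]≡#circledOfLength : ∀ j → [ C′.c j ] ≡ #circledOfLength j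
  [c′]≡#circledOfLength j = +-cancelʳ-≡ (#longerThan j) _ _ (begin
    [ C′.c j ] + #longerThan j            ≡⟨ cong ([ C′.c j ] +_) (ℓ′≡#longerThan j) ⟨
    width (rowAt (rows Λ') j)             ≡⟨ D′.get-circ j ⟨
    get (circ Λ') j                       ≡⟨ cong (λ xs → get xs j) circ-conj ⟩
    get (conj (circ Λ)) j                 ≡⟨ get-conj-circ j ⟩
    ∑[ i < L ] [ suc j ≤ᵇ width (rowAt (rows Λ) i) ] ≡⟨ ∑-cong L (λ i _ → [≤ᵇ-width] j (rowAt (rows Λ) i)) ⟩
    ∑[ i < L ] ([ suc j ≤ᵇ ℓ i ] + [ c i ] * [ ℓ i ≡ᵇ j ]) ≡⟨ ∑-+ L _ _ ⟩
    #longerThan j + #circledOfLength j    ≡⟨ +-comm (#longerThan j) _ ⟩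
    #circledOfLength j + #longerThan j    ∎)
    where open ≡-Reasoning

  #circledAbove′≡#circledShorterThan : ∀ j → C′.#circledAbove j ≡ #circledShorterThan j
  #circledAbove′≡#circledShorterThan j = trans (∑-cong j (λ k _ → [c′]≡#circledOfLength k)) (∑-#circledOfLength j)

  nPart-anti′ : nPart (anti Λ') ≡ ∑[ i < L ] ([ c i ] * (i * #circledShorterThan (ℓ i)))
  nPart-anti′ = begin
    nPart (anti Λ')
      ≡⟨ cong nPart D′.anti≡circledLens ⟩
    nPart (circledLens (rows Λ'))
      ≡⟨ Σ<≡∑ (length (circledLens (rows Λ'))) _ ⟩
    nPartFrom 0 (circledLens (rows Λ'))
      ≡⟨ nPartFrom-circledLens 0 (rows Λ') ⟩
    ∑[ j < C′.L ] ([ C′.c j ] * (C′.#circledAbove j * C′.ℓ j))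
      ≡⟨ ∑-extend C′.L N _ (m≤m+n C′.L _) no-row ⟩
    ∑[ j < N ] ([ C′.c j ] * (C′.#circledAbove j * C′.ℓ j))
      ≡⟨ ∑-cong N (λ j _ → cong₂ _*_ ([c′]≡#circledOfLength j)
                                     (cong₂ _*_ (#circledAbove′≡#circledShorterThan j) (ℓ′≡#longerThan j))) ⟩
    ∑[ j < N ] (#circledOfLength j * (#circledShorterThan j * #longerThan j))
      ≡⟨ ∑-circledOfLength N (λ j → #circledShorterThan j * #longerThan j) ℓ<N ⟩
    ∑[ i < L ] ([ c i ] * (#circledShorterThan (ℓ i) * #longerThan (ℓ i)))
      ≡⟨ ∑-cong L (λ i _ → circled-row i) ⟩
    ∑[ i < L ] ([ c i ] * (i * #circledShorterThan (ℓ i))) ∎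
    where
    open ≡-Reasoning
    N : ℕ
    N = C′.L + suc (ℓ 0)
    ℓ<N : ∀ i → ℓ i < N
    ℓ<N i = ≤-trans (s≤s (ℓ-antitone z≤n)) (m≤n+m (suc (ℓ 0)) C′.L)
    no-row : ∀ j → C′.L ≤ j → j < N → [ C′.c j ] * (C′.#circledAbove j * C′.ℓ j) ≡ 0
    no-row j L′≤j _ = cong (λ r → [ circled r ] * (C′.#circledAbove j * C′.ℓ j)) (rowAt-beyond (rows Λ') j L′≤j)
    circled-row : ∀ i → [ c i ] * (#circledShorterThan (ℓ i) * #longerThan (ℓ i)) ≡ [ c i ] * (i * #circledShorterThan (ℓ i))
    circled-row i with c i in ci
    ... | false = refl
    ... | true  = cong (1 *_) (trans (cong (#circledShorterThan (ℓ i) *_) (#longerThan-circled ci)) (*-comm _ i))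

lemma5p13 : (m : ℕ) (Λ Λ' : SuperPartition) → IsSuperPartition Λ → fermDeg Λ ≡ m → IsSuperPartition Λ' → star Λ' ≡ conj (star Λ) → circ Λ' ≡ conj (circ Λ) → ζ Λ + nPart (δ m) ≡ nPart (anti Λ')
lemma5p13 m Λ Λ' valid deg≡m valid' star-conj circ-conj = begin
  ζ Λ + nPart (δ m)
    ≡⟨ cong (λ k → ζ Λ + nPart (δ k)) (trans (≡-sym deg≡m) fermDeg≡#circled) ⟩
  ζ Λ + nPart (δ #circled)
    ≡⟨ cong₂ _+_ ζ-as-∑ nPart-δ-#circled ⟩
  ∑[ i < L ] ([ c i ] * (#plainAbove i * w i)) + ∑[ i < L ] ([ c i ] * (#circledAbove i * w i))
    ≡⟨ ∑-circled-rowsAbove w ⟩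
  ∑[ i < L ] ([ c i ] * (i * w i))
    ≡⟨ nPart-anti′ ⟨
  nPart (anti Λ') ∎
  where
  open ≡-Reasoning
  open Diagram valid using (ordered; fermDeg≡#circled)
  open Counting (rows Λ) ordered
  open Fermionic valid using (ζ-as-∑)
  open Conjugate valid valid' star-conj circ-conj using (nPart-anti′)
  w : ℕ → ℕ
  w i = #circledShorterThan (ℓ i)
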